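{- Let $n>m$ be positive integers, let $\mathcal{N}$ be a normal system of $n$ lines in $\mathbb{R}^m$ with fixed coefficient matrix $[a_{ij}]$, and let $\mathcal{C}^n_{\binom{n}{m+1}}$ be its discriminantal arrangement in $\mathbb{R}^n$. Let $1\le i_1<\cdots<i_m\le n$ and $I=\{i_1,\ldots,i_m\}$. Given arbitrary real values $c_{i_1},\ldots,c_{i_m}$, for each $j\notin I$ let $c_j$ be the unique real number such that the point with $y_{i_k}=c_{i_k}$ ($1\le k\le m$) and $y_j=c_j$ satisfies the equation of $M_{I\cup\{j\}}$. Then the vector $(c_1,\ldots,c_n)\in\mathbb{R}^n$ lies on every hyperplane $M_{\{j_1,\ldots,j_{m+1}\}}$ of the discriminantal arrangement.
   Context: A normal system in $\mathbb{R}^m$ is a set of lines $L_1,\ldots,L_n$ through the origin with chosen nonzero vectors $v_i=(a_{i1},\ldots,a_{im})\in L_i$ such that any at most $m$ of the $v_i$ are linearly independent; the matrix $[a_{ij}]$ is fixed. The discriminantal arrangement consists of, for each $(m+1)$-subset $\{i_1<\cdots<i_{m+1}\}\subset\{1,\ldots,n\}$, the hyperplane $M_{\{i_1,\ldots,i_{m+1}\}}\subset\mathbb{R}^n$ (coordinates $y_1,\ldots,y_n$) defined by vanishing of the determinant of the $(m+1)\times(m+1)$ matrix with rows $(a_{i_k1},\ldots,a_{i_km},y_{i_k})$, $k=1,\ldots,m+1$. (The coefficient of $y_j$ in the equation of $M_{I\cup\{j\}}$ is, up to sign, the nonzero determinant of the rows $v_{i_1},\ldots,v_{i_m}$, so $c_j$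 is uniquely determined.) -}

module Defs where

open import Level using (Level; _⊔_) renaming (suc to lsuc)
open import Data.Nat using (ℕ; zero; suc; _≤_)
open import Data.Fin using (Fin; zero; suc; punchIn) renaming (_<_ to _<ᶠ_)
open import Data.Product using (∃; Σ; _×_; _,_)
open import Data.Sum using (_⊎_)
open import Relation.Nullary using (¬_)
open import Relation.Binary.PropositionalEquality using (_≡_)
open import Algebra.Bundles using (CommutativeRing)

record Field (c ℓ : Level) : Set (lsuc (c ⊔ ℓ)) where
  field
    commutativeRing : CommutativeRing c ℓ
  open CommutativeRing commutativeRing public
  field
    1≉0 : ¬ (1# ≈ 0#)
    inverse : ∀ x → ¬ (x ≈ 0#) → ∃ λ y → (x * y) ≈ 1#

-- Strictly increasing maps Fin k → Fin n  (= k-subsets {i₁ < ⋯ < i_k} of {1,…,n}).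
StrictlyIncreasing : ∀ {k n} → (Fin k → Fin n) → Set
StrictlyIncreasing ι = ∀ a b → a <ᶠ b → ι a <ᶠ ι b

module FieldDefs {c ℓ} (F : Field c ℓ) where
  open Field F using (Carrier; _≈_; _+_; _*_; -_; 0#; 1#)

  sumF : ∀ k → (Fin k → Carrier) → Carrier
  sumF zero    f = 0#
  sumF (suc k) f = f zero + sumF k (λ i → f (suc i))

  sgn : ∀ {k} → Fin k → Carrier
  sgn zero    = 1#
  sgn (suc j) = - sgn j

  det : ∀ k → (Fin k → Fin k → Carrier) → Carrier
  det zero    M = 1#
  det (suc k) M = sumF (suc k) λ j →
    sgn j * (M zero j * det k (λ r s → M (suc r) (punchIn j s)))

  snoc : ∀ {m} → (Fin m → Carrier) → Carrier → Fin (suc m) → Carrier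
  snoc {zero}  f y zero    = y
  snoc {suc m} f y zero    = f zero
  snoc {suc m} f y (suc i) = snoc (λ t → f (suc t)) y i

  LinearlyIndependent : ∀ {k m} → (Fin k → Fin m → Carrier) → Set (c ⊔ ℓ)
  LinearlyIndependent {k} {m} w =
    (λs : Fin k → Carrier) →
    (∀ col → sumF k (λ t → λs t * w t col) ≈ 0#) →
    ∀ t → λs t ≈ 0#

  -- normal system: v : Fin n → Fin m → F, row i is v_i = (a_{i1},…,a_{im});
  -- any at most m of the v_i (with distinct indices) are linearly independent
  NormalSystem : ∀ {m n} → (Fin n → Fin m → Carrier) → Set (c ⊔ ℓ)
  NormalSystem {m} {n} v =
    ∀ k → k ≤ m → (ι : Fin k → Fin n) →
    (∀ a b → ι a ≡ ι b → a ≡ b) →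
    LinearlyIndependent (λ t → v (ι t))

  -- the point y lies on the hyperplane M_{i₁,…,i_{m+1}} of the discriminantal
  -- arrangement, where ι enumerates i₁ < ⋯ < i_{m+1}:
  -- det of the matrix with rows (a_{i_k 1},…,a_{i_k m}, y_{i_k}) vanishes
  OnHyperplane : ∀ {m n} → (Fin n → Fin m → Carrier) → (Fin n → Carrier) →
                 (Fin (suc m) → Fin n) → Set ℓ
  OnHyperplane {m} v y ι = det (suc m) (λ k → snoc (v (ι k)) (y (ι k))) ≈ 0#

-- Expanding along the last column, the equation of M_κ reads N_κ · y = 0, where the normal
-- N_κ carries the signed m-minors of the rows v_κ at the positions κ; N_κ is orthogonal to
-- every column of [a_ij], being a determinant with a repeated column. For j ∉ I the normal of
-- M_{I ∪ {j}} has, outside I, the single entry ±det(v_I) at j, and det(v_I) ≠ 0 since the rows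
-- v_I are independent. Subtracting suitable multiples of these normals from any N_ι leaves a
-- vector supported on I and orthogonal to all columns, i.e. a linear relation among the rows
-- v_I, hence zero. So N_ι is a combination of the normals of the M_{I ∪ {j}}, and y, lying on
-- all of those, lies on M_ι.

module Submission where

open import Defs
open import Level using (_⊔_)
open import Data.Nat as ℕ using (ℕ; zero; suc; z≤n; s≤s; _≤_; _<_)
import Data.Nat.Properties as ℕ
open import Data.Fin using (Fin; zero; suc; toℕ; punchIn; punchOut; inject₁; fromℕ)
open import Data.Fin.Properties
  using (_≟_; any?; <-cmp; <-irrefl; toℕ-injective; toℕ-fromℕ; toℕ≤pred[n]; punchIn-punchOut;
         punchInᵢ≢i; suc-injective; inject₁-injective)
open import Data.Fin.Induction using (>-weakInduction)
open import Data.Vec.Functional using (Vector; insertAt)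
open import Data.Vec.Functional.Properties using (insertAt-lookup; insertAt-punchIn; insertAt-removeAt)
open import Data.Product using (Σ; ∃; _×_; _,_; proj₁; proj₂)
open import Data.Sum using (_⊎_; inj₁; inj₂)
open import Data.Empty using (⊥-elim)
open import Function using (_∘_; id)
open import Relation.Binary.Definitions using (tri<; tri≈; tri>)
open import Relation.Nullary using (¬_; Dec; yes; no)
open import Relation.Binary.PropositionalEquality as ≡
  using (_≡_; _≢_; _≗_)

transposeAdj : ∀ {k} → Fin k → Fin (suc k) → Fin (suc k)
transposeAdj zero    zero          = suc zero
transposeAdj zero    (suc zero)    = zero
transposeAdj zero    (suc (suc t)) = suc (suc t)
transposeAdj (suc c) zero          = zero
transposeAdj (suc c) (suc t)       = suc (transposeAdj c t)

transposeAdj-inject₁ : ∀ {k} (c : Fin k) → transposeAdj c (inject₁ c) ≡ suc c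
transposeAdj-inject₁ zero    = ≡.refl
transposeAdj-inject₁ (suc c) = ≡.cong suc (transposeAdj-inject₁ c)

transposeAdj-suc : ∀ {k} (c : Fin k) → transposeAdj c (suc c) ≡ inject₁ c
transposeAdj-suc zero    = ≡.refl
transposeAdj-suc (suc c) = ≡.cong suc (transposeAdj-suc c)

transposeAdj-fix : ∀ {k} (c : Fin k) {j} → j ≢ inject₁ c → j ≢ suc c → transposeAdj c j ≡ j
transposeAdj-fix zero    {zero}          j≢c _   = ⊥-elim (j≢c ≡.refl)
transposeAdj-fix zero    {suc zero}      _   j≢c = ⊥-elim (j≢c ≡.refl)
transposeAdj-fix zero    {suc (suc j)}   _   _   = ≡.refl
transposeAdj-fix (suc c) {zero}          _   _   = ≡.refl
transposeAdj-fix (suc c) {suc j} j≢c j≢c+1 =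
  ≡.cong suc (transposeAdj-fix c (j≢c ∘ ≡.cong suc) (j≢c+1 ∘ ≡.cong suc))

transposeAdj-punchIn-inject₁ : ∀ {k} (c : Fin (suc k)) s →
  transposeAdj c (punchIn (inject₁ c) s) ≡ punchIn (suc c) s
transposeAdj-punchIn-inject₁ zero            zero    = ≡.refl
transposeAdj-punchIn-inject₁ zero            (suc s) = ≡.refl
transposeAdj-punchIn-inject₁ {suc k} (suc c) zero    = ≡.refl
transposeAdj-punchIn-inject₁ {suc k} (suc c) (suc s) = ≡.cong suc (transposeAdj-punchIn-inject₁ c s)

transposeAdj-punchIn-suc : ∀ {k} (c : Fin (suc k)) s →
  transposeAdj c (punchIn (suc c) s) ≡ punchIn (inject₁ c) s
transposeAdj-punchIn-suc zero            zero    = ≡.refl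
transposeAdj-punchIn-suc zero            (suc s) = ≡.refl
transposeAdj-punchIn-suc {suc k} (suc c) zero    = ≡.refl
transposeAdj-punchIn-suc {suc k} (suc c) (suc s) = ≡.cong suc (transposeAdj-punchIn-suc c s)

punchIn-adjacent : ∀ {k} (c : Fin (suc k)) s →
  punchIn (inject₁ c) s ≡ punchIn (suc c) s ⊎
  (punchIn (inject₁ c) s ≡ suc c × punchIn (suc c) s ≡ inject₁ c)
punchIn-adjacent zero            zero    = inj₂ (≡.refl , ≡.refl)
punchIn-adjacent zero            (suc s) = inj₁ ≡.refl
punchIn-adjacent {suc k} (suc c) zero    = inj₁ ≡.refl
punchIn-adjacent {suc k} (suc c) (suc s) with punchIn-adjacent c s
... | inj₁ eq         = inj₁ (≡.cong suc eq)
... | inj₂ (eq , eq′) = inj₂ (≡.cong suc eq , ≡.cong suc eq′)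

punchIn-transposeAdj : ∀ {k} (c : Fin (suc k)) {j} → j ≢ inject₁ c → j ≢ suc c →
  Σ (Fin k) λ c′ → punchIn j (inject₁ c′) ≡ inject₁ c × punchIn j (suc c′) ≡ suc c ×
    (∀ s → transposeAdj c (punchIn j s) ≡ punchIn j (transposeAdj c′ s))
punchIn-transposeAdj zero            {zero}        j≢c _     = ⊥-elim (j≢c ≡.refl)
punchIn-transposeAdj zero            {suc zero}    _   j≢c+1 = ⊥-elim (j≢c+1 ≡.refl)
punchIn-transposeAdj {suc k} zero    {suc (suc j)} _   _     = zero , ≡.refl , ≡.refl , commute
  where
  commute : ∀ s → transposeAdj zero (punchIn (suc (suc j)) s) ≡ punchIn (suc (suc j)) (transposeAdj zero s)
  commute zero          = ≡.refl
  commute (suc zero)    = ≡.refl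
  commute (suc (suc s)) = ≡.refl
punchIn-transposeAdj (suc c)         {zero}        _   _     = c , ≡.refl , ≡.refl , λ _ → ≡.refl
punchIn-transposeAdj {suc k} (suc c) {suc j} j≢c j≢c+1
  with punchIn-transposeAdj c (j≢c ∘ ≡.cong suc) (j≢c+1 ∘ ≡.cong suc)
... | c′ , eq , eq′ , commute = suc c′ , ≡.cong suc eq , ≡.cong suc eq′ , commute′
  where
  commute′ : ∀ s → transposeAdj (suc c) (punchIn (suc j) s) ≡ punchIn (suc j) (transposeAdj (suc c′) s)
  commute′ zero    = ≡.refl
  commute′ (suc s) = ≡.cong suc (commute s)

pivot-or-punchIn : ∀ {k} (i j : Fin (suc k)) → j ≡ i ⊎ ∃ λ t → punchIn i t ≡ j
pivot-or-punchIn i j with j ≟ i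
... | yes j≡i = inj₁ j≡i
... | no  j≢i = inj₂ (punchOut (j≢i ∘ ≡.sym) , punchIn-punchOut (j≢i ∘ ≡.sym))

punchIn-fromℕ : ∀ {k} (s : Fin k) → punchIn (fromℕ k) s ≡ inject₁ s
punchIn-fromℕ zero    = ≡.refl
punchIn-fromℕ (suc s) = ≡.cong suc (punchIn-fromℕ s)

punchIn-inject₁-fromℕ : ∀ {k} (t : Fin (suc k)) → punchIn (inject₁ t) (fromℕ k) ≡ fromℕ (suc k)
punchIn-inject₁-fromℕ {zero}  zero    = ≡.refl
punchIn-inject₁-fromℕ {suc k} zero    = ≡.refl
punchIn-inject₁-fromℕ {suc k} (suc t) = ≡.cong suc (punchIn-inject₁-fromℕ t)

module _ {a} {A : Set a} where

  insertAt-map : ∀ {b} {B : Set b} {k} (f : A → B) (xs : Vector A k) i x j →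
    f (insertAt xs i x j) ≡ insertAt (f ∘ xs) i (f x) j
  insertAt-map             f xs zero    x zero    = ≡.refl
  insertAt-map             f xs zero    x (suc j) = ≡.refl
  insertAt-map {k = suc k} f xs (suc i) x zero    = ≡.refl
  insertAt-map {k = suc k} f xs (suc i) x (suc j) = insertAt-map f (xs ∘ suc) i x j

  insertAt-cong : ∀ {k} {xs ys : Vector A k} {x y : A} (i : Fin (suc k)) →
    xs ≗ ys → x ≡ y → insertAt xs i x ≗ insertAt ys i y
  insertAt-cong             zero    _     x≡y zero    = x≡y
  insertAt-cong             zero    xs≗ys _   (suc j) = xs≗ys j
  insertAt-cong {k = suc k} (suc i) xs≗ys _   zero    = xs≗ys zero
  insertAt-cong {k = suc k} (suc i) xs≗ys x≡y (suc j) = insertAt-cong i (xs≗ys ∘ suc) x≡y j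

  insertAt-last-inject₁ : ∀ {k} (xs : Vector A k) x j → insertAt xs (fromℕ k) x (inject₁ j) ≡ xs j
  insertAt-last-inject₁ {k} xs x j =
    ≡.trans (≡.cong (insertAt xs (fromℕ k) x) (≡.sym (punchIn-fromℕ j))) (insertAt-punchIn xs (fromℕ k) x j)

  insertAt-last-punchIn : ∀ {k} (xs : Vector A (suc k)) x (j : Fin (suc k)) s →
    insertAt xs (fromℕ (suc k)) x (punchIn (inject₁ j) s) ≡ insertAt (xs ∘ punchIn j) (fromℕ k) x s
  insertAt-last-punchIn             xs x zero    s       = ≡.refl
  insertAt-last-punchIn {k = suc k} xs x (suc j) zero    = ≡.refl
  insertAt-last-punchIn {k = suc k} xs x (suc j) (suc s) = insertAt-last-punchIn (xs ∘ suc) x j s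

  insertAt-all : ∀ {p} (P : A → Set p) {k} (xs : Vector A k) i {x} →
    P x → (∀ t → P (xs t)) → ∀ j → P (insertAt xs i x j)
  insertAt-all P xs i {x} Px Pxs j with pivot-or-punchIn i j
  ... | inj₁ ≡.refl       = ≡.subst P (≡.sym (insertAt-lookup xs i x)) Px
  ... | inj₂ (t , ≡.refl) = ≡.subst P (≡.sym (insertAt-punchIn xs i x t)) (Pxs t)

  insertAt-image : ∀ {k} (xs : Vector A k) i x {y} →
    (∃ λ j → insertAt xs i x j ≡ y) → (∃ λ t → xs t ≡ y) ⊎ y ≡ x
  insertAt-image xs i x (j , eq) with pivot-or-punchIn i j
  ... | inj₁ ≡.refl       = inj₂ (≡.trans (≡.sym eq) (insertAt-lookup xs i x))
  ... | inj₂ (t , ≡.refl) = inj₁ (t , ≡.trans (≡.sym (insertAt-punchIn xs i x t)) eq)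

  image-insertAt : ∀ {k} (xs : Vector A k) i x {y} →
    (∃ λ t → xs t ≡ y) ⊎ y ≡ x → ∃ λ j → insertAt xs i x j ≡ y
  image-insertAt xs i x (inj₁ (t , eq)) = punchIn i t , ≡.trans (insertAt-punchIn xs i x t) eq
  image-insertAt xs i x (inj₂ eq)       = i , ≡.trans (insertAt-lookup xs i x) (≡.sym eq)

moveToLast : ∀ {k} → Fin (suc k) → Fin (suc k) → Fin (suc k)
moveToLast {k} q = insertAt (punchIn q) (fromℕ k) q

moveToLast-fromℕ : ∀ k → moveToLast (fromℕ k) ≗ id
moveToLast-fromℕ k = insertAt-removeAt id (fromℕ k)

moveToLast-inject₁ : ∀ {k} (i : Fin k) t →
  moveToLast (inject₁ i) t ≡ transposeAdj i (moveToLast (suc i) t)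
moveToLast-inject₁ {suc k} i t = ≡.sym (≡.trans
  (insertAt-map (transposeAdj i) (punchIn (suc i)) (fromℕ (suc k)) (suc i) t)
  (insertAt-cong (fromℕ (suc k)) (transposeAdj-punchIn-suc i) (transposeAdj-suc i) t))

strictlyIncreasing⇒injective : ∀ {k N} {γ : Fin k → Fin N} → StrictlyIncreasing γ →
  ∀ a b → γ a ≡ γ b → a ≡ b
strictlyIncreasing⇒injective γ↑ a b γa≡γb with <-cmp a b
... | tri< a<b _ _ = ⊥-elim (<-irrefl γa≡γb (γ↑ a b a<b))
... | tri≈ _ a≡b _ = a≡b
... | tri> _ _ b<a = ⊥-elim (<-irrefl (≡.sym γa≡γb) (γ↑ b a b<a))

strictlyIncreasing-tail : ∀ {k N} {γ : Fin (suc k) → Fin N} →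
  StrictlyIncreasing γ → StrictlyIncreasing (γ ∘ suc)
strictlyIncreasing-tail γ↑ a b a<b = γ↑ (suc a) (suc b) (s≤s a<b)

insertAt-strictlyIncreasing : ∀ {k N} {xs : Fin k → Fin N} → StrictlyIncreasing xs →
  ∀ x → (∀ t → xs t ≢ x) → ∃ λ q → StrictlyIncreasing (insertAt xs q x)
insertAt-strictlyIncreasing {zero} _ x _ = zero , λ { zero zero () }
insertAt-strictlyIncreasing {suc k} {xs = xs} xs↑ x x∉xs with <-cmp x (xs zero)
... | tri< x<xs₀ _ _ = zero , x∷xs↑
  where
  x∷xs↑ : StrictlyIncreasing (insertAt xs zero x)
  x∷xs↑ zero    (suc zero)    _         = x<xs₀
  x∷xs↑ zero    (suc (suc b)) _         = ℕ.<-trans x<xs₀ (xs↑ zero (suc b) (s≤s z≤n))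
  x∷xs↑ (suc a) (suc b)       (s≤s a<b) = xs↑ a b a<b
... | tri≈ _ x≡xs₀ _ = ⊥-elim (x∉xs zero (≡.sym x≡xs₀))
... | tri> _ _ xs₀<x with insertAt-strictlyIncreasing (strictlyIncreasing-tail xs↑) x (x∉xs ∘ suc)
...   | q , rest↑ = suc q , xs₀∷rest↑
  where
  xs₀<rest : ∀ j → toℕ (xs zero) ℕ.< toℕ (insertAt (xs ∘ suc) q x j)
  xs₀<rest = insertAt-all (λ y → toℕ (xs zero) ℕ.< toℕ y) (xs ∘ suc) q xs₀<x
               (λ t → xs↑ zero (suc t) (s≤s z≤n))
  xs₀∷rest↑ : StrictlyIncreasing (insertAt xs (suc q) x)
  xs₀∷rest↑ zero    (suc b) _         = xs₀<rest b
  xs₀∷rest↑ (suc a) (suc b) (s≤s a<b) = rest↑ a b a<b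

strictlyIncreasing-lowerBound : ∀ {k N} {γ : Fin (suc k) → Fin N} → StrictlyIncreasing γ →
  ∀ t → toℕ (γ zero) ℕ.+ toℕ t ℕ.≤ toℕ (γ t)
strictlyIncreasing-lowerBound {γ = γ} _ zero = ℕ.≤-reflexive (ℕ.+-identityʳ (toℕ (γ zero)))
strictlyIncreasing-lowerBound {suc k} {γ = γ} γ↑ (suc t) = begin
  toℕ (γ zero) ℕ.+ suc (toℕ t) ≡⟨ ℕ.+-suc (toℕ (γ zero)) (toℕ t) ⟩
  suc (toℕ (γ zero)) ℕ.+ toℕ t ≤⟨ ℕ.+-monoˡ-≤ (toℕ t) (γ↑ zero (suc zero) (s≤s z≤n)) ⟩
  toℕ (γ (suc zero)) ℕ.+ toℕ t ≤⟨ strictlyIncreasing-lowerBound (strictlyIncreasing-tail γ↑) t ⟩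
  toℕ (γ (suc t))              ∎
  where open ℕ.≤-Reasoning

strictlyIncreasing-upperBound : ∀ {k N} {γ : Fin (suc k) → Fin N} → StrictlyIncreasing γ →
  ∀ t → toℕ (γ t) ℕ.+ (k ℕ.∸ toℕ t) ℕ.≤ toℕ (γ (fromℕ k))
strictlyIncreasing-upperBound {k} {γ = γ} γ↑ zero =
  ≡.subst (λ d → toℕ (γ zero) ℕ.+ d ℕ.≤ toℕ (γ (fromℕ k))) (toℕ-fromℕ k)
    (strictlyIncreasing-lowerBound γ↑ (fromℕ k))
strictlyIncreasing-upperBound {suc k} γ↑ (suc t) =
  strictlyIncreasing-upperBound (strictlyIncreasing-tail γ↑) t

strictlyIncreasing-endo≗id : ∀ {k} {γ : Fin k → Fin k} → StrictlyIncreasing γ → γ ≗ id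
strictlyIncreasing-endo≗id {suc k} {γ} γ↑ t = toℕ-injective (ℕ.≤-antisym γt≤t t≤γt)
  where
  t≤γt : toℕ t ℕ.≤ toℕ (γ t)
  t≤γt = ℕ.≤-trans (ℕ.m≤n+m (toℕ t) _) (strictlyIncreasing-lowerBound γ↑ t)
  γt≤t : toℕ (γ t) ℕ.≤ toℕ t
  γt≤t = ℕ.+-cancelʳ-≤ (k ℕ.∸ toℕ t) _ _ (begin
    toℕ (γ t) ℕ.+ (k ℕ.∸ toℕ t) ≤⟨ strictlyIncreasing-upperBound γ↑ t ⟩
    toℕ (γ (fromℕ k))           ≤⟨ toℕ≤pred[n] (γ (fromℕ k)) ⟩
    k                           ≡⟨ ℕ.m+[n∸m]≡n (toℕ≤pred[n] t) ⟨
    toℕ t ℕ.+ (k ℕ.∸ toℕ t)     ∎)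
    where open ℕ.≤-Reasoning

module Determinants {c ℓ} (F : Field c ℓ) where
  open Field F hiding (zero)
  open FieldDefs F
  open import Algebra.Properties.Ring ring using (-‿distribˡ-*; -‿distribʳ-*; -‿involutive; -1*x≈-x)
  open import Algebra.Properties.Semiring.Sum semiring
    using (sum; sum-cong-≋; sum-replicate-zero; sum-remove; sum-init-last;
           ∑-comm; ∑-distrib-+; *-distribˡ-sum; *-distribʳ-sum)
  open import Relation.Binary.Reasoning.Setoid setoid

  open import Algebra.Solver.CommutativeMonoid *-commutativeMonoid using (solve; _⊕_; _⊜_)

  regroup : ∀ e x d → e * (x * d) ≈ e * d * x
  regroup = solve 3 (λ e x d → e ⊕ (x ⊕ d) ⊜ (e ⊕ d) ⊕ x) refl

  sumF≡sum : ∀ k (f : Vector Carrier k) → sumF k f ≡ sum f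
  sumF≡sum zero    f = ≡.refl
  sumF≡sum (suc k) f = ≡.cong (f zero +_) (sumF≡sum k (f ∘ suc))

  sum-zero : ∀ {k} {f : Vector Carrier k} → (∀ i → f i ≈ 0#) → sum f ≈ 0#
  sum-zero {k} f≈0 = trans (sum-cong-≋ f≈0) (sum-replicate-zero k)

  sum-single : ∀ {k} (f : Vector Carrier k) p → (∀ i → i ≢ p → f i ≈ 0#) → sum f ≈ f p
  sum-single {suc k} f p f≈0 = begin
    sum f                      ≈⟨ sum-remove {i = p} f ⟩
    f p + sum (f ∘ punchIn p)  ≈⟨ +-congˡ (sum-zero (λ i → f≈0 (punchIn p i) (punchInᵢ≢i p i))) ⟩
    f p + 0#                   ≈⟨ +-identityʳ (f p) ⟩
    f p                        ∎

  -‿sum : ∀ {k} (f : Vector Carrier k) → - sum f ≈ sum (λ i → - f i)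
  -‿sum f = begin
    - sum f                    ≈⟨ -1*x≈-x (sum f) ⟨
    - 1# * sum f               ≈⟨ *-distribˡ-sum (- 1#) f ⟩
    sum (λ i → - 1# * f i)     ≈⟨ sum-cong-≋ (λ i → -1*x≈-x (f i)) ⟩
    sum (λ i → - f i)          ∎

  sum-adjacentPair : ∀ {k} (c : Fin (suc k)) {f g : Vector Carrier (suc (suc k))} →
    (∀ j → j ≢ inject₁ c → j ≢ suc c → f j ≈ g j) →
    f (inject₁ c) + f (suc c) ≈ g (inject₁ c) + g (suc c) → sum f ≈ sum g
  sum-adjacentPair {k} zero {f} {g} f≈g pair≈ = begin
    f zero + (f (suc zero) + sum {k} (λ i → f (suc (suc i))))
      ≈⟨ +-assoc _ _ _ ⟨
    (f zero + f (suc zero)) + sum {k} (λ i → f (suc (suc i)))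
      ≈⟨ +-cong pair≈ (sum-cong-≋ (λ i → f≈g (suc (suc i)) (λ ()) (λ ()))) ⟩
    (g zero + g (suc zero)) + sum {k} (λ i → g (suc (suc i)))
      ≈⟨ +-assoc _ _ _ ⟩
    g zero + (g (suc zero) + sum {k} (λ i → g (suc (suc i)))) ∎
  sum-adjacentPair {suc k} (suc c) f≈g pair≈ =
    +-cong (f≈g zero (λ ()) (λ ()))
      (sum-adjacentPair c (λ j j≢c j≢c+1 → f≈g (suc j) (j≢c ∘ suc-injective) (j≢c+1 ∘ suc-injective)) pair≈)

  sgn-inject₁ : ∀ {k} (j : Fin k) → sgn (inject₁ j) ≡ sgn j
  sgn-inject₁ zero    = ≡.refl
  sgn-inject₁ (suc j) = ≡.cong -_ (sgn-inject₁ j)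

  sgn-involutive : ∀ {k} (j : Fin k) → sgn j * sgn j ≈ 1#
  sgn-involutive zero    = *-identityˡ 1#
  sgn-involutive (suc j) = begin
    - sgn j * - sgn j      ≈⟨ -‿distribˡ-* (sgn j) (- sgn j) ⟨
    - (sgn j * - sgn j)    ≈⟨ -‿cong (-‿distribʳ-* (sgn j) (sgn j)) ⟨
    - - (sgn j * sgn j)    ≈⟨ -‿involutive (sgn j * sgn j) ⟩
    sgn j * sgn j          ≈⟨ sgn-involutive j ⟩
    1#                     ∎

  -- (-1)^(k - q), the sign of moving column q of a (k+1)-column matrix to the end.
  sgnToLast : ∀ {k} → Fin (suc k) → Carrier
  sgnToLast {k}     zero    = sgn (fromℕ k)
  sgnToLast {suc k} (suc q) = sgnToLast q

  sgnToLast-fromℕ : ∀ k → sgnToLast (fromℕ k) ≡ 1#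
  sgnToLast-fromℕ zero    = ≡.refl
  sgnToLast-fromℕ (suc k) = sgnToLast-fromℕ k

  sgnToLast-inject₁ : ∀ {k} (i : Fin k) → sgnToLast (inject₁ i) ≡ - sgnToLast (suc i)
  sgnToLast-inject₁ {suc k} zero    = ≡.refl
  sgnToLast-inject₁ {suc k} (suc i) = sgnToLast-inject₁ i

  sgnToLast-involutive : ∀ {k} (q : Fin (suc k)) → sgnToLast q * sgnToLast q ≈ 1#
  sgnToLast-involutive {k}     zero    = sgn-involutive (fromℕ k)
  sgnToLast-involutive {suc k} (suc q) = sgnToLast-involutive q

  sgnToLast-cancel : ∀ {k} (q : Fin (suc k)) {x} → sgnToLast q * x ≈ 0# → x ≈ 0#
  sgnToLast-cancel q {x} εx≈0 = begin
    x                                ≈⟨ *-identityˡ x ⟨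
    1# * x                           ≈⟨ *-congʳ (sgnToLast-involutive q) ⟨
    sgnToLast q * sgnToLast q * x    ≈⟨ *-assoc _ _ _ ⟩
    sgnToLast q * (sgnToLast q * x)  ≈⟨ *-congˡ εx≈0 ⟩
    sgnToLast q * 0#                 ≈⟨ zeroʳ _ ⟩
    0#                               ∎

  Matrix : ℕ → ℕ → Set c
  Matrix k l = Fin k → Fin l → Carrier

  minor : ∀ {k} → Matrix (suc k) (suc k) → Fin (suc k) → Matrix k k
  minor M j r s = M (suc r) (punchIn j s)

  expansionTerm : ∀ {k} → Matrix (suc k) (suc k) → Fin (suc k) → Carrier
  expansionTerm {k} M j = sgn j * (M zero j * det k (minor M j))

  det-expand : ∀ k (M : Matrix (suc k) (suc k)) → det (suc k) M ≡ sum (expansionTerm M)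
  det-expand k M = sumF≡sum (suc k) (expansionTerm M)

  det-cong : ∀ k {M N : Matrix k k} → (∀ r s → M r s ≈ N r s) → det k M ≈ det k N
  det-cong zero    M≈N = refl
  det-cong (suc k) {M} {N} M≈N = begin
    det (suc k) M            ≡⟨ det-expand k M ⟩
    sum (expansionTerm M)    ≈⟨ sum-cong-≋ {x = expansionTerm M} {y = expansionTerm N} terms≈ ⟩
    sum (expansionTerm N)    ≡⟨ det-expand k N ⟨
    det (suc k) N            ∎
    where
    terms≈ : ∀ j → expansionTerm M j ≈ expansionTerm N j
    terms≈ j = *-congˡ (*-cong (M≈N zero j) (det-cong k (λ r s → M≈N (suc r) (punchIn j s))))

  det-adjacentColumns≈ : ∀ {k} (M : Matrix (suc k) (suc k)) (c : Fin k) →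
    (∀ r → M r (inject₁ c) ≈ M r (suc c)) → det (suc k) M ≈ 0#
  det-adjacentColumns≈ {suc k} M c cols≈ = begin
    det (suc (suc k)) M           ≡⟨ det-expand (suc k) M ⟩
    sum T                         ≈⟨ sum-adjacentPair c {f = T} offPair pairCancels ⟩
    sum {suc (suc k)} (λ _ → 0#)  ≈⟨ sum-replicate-zero (suc (suc k)) ⟩
    0#                            ∎
    where
    T = expansionTerm M
    offPair : ∀ j → j ≢ inject₁ c → j ≢ suc c → T j ≈ 0#
    offPair j j≢c j≢c+1 with punchIn-transposeAdj c j≢c j≢c+1
    ... | c′ , pc′≡c , pc′+1≡c+1 , _ = begin
      T j                      ≈⟨ *-congˡ (*-congˡ (det-adjacentColumns≈ (minor M j) c′ minorCols≈)) ⟩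
      sgn j * (M zero j * 0#)  ≈⟨ *-congˡ (zeroʳ _) ⟩
      sgn j * 0#               ≈⟨ zeroʳ _ ⟩
      0#                       ∎
      where
      minorCols≈ : ∀ r → minor M j r (inject₁ c′) ≈ minor M j r (suc c′)
      minorCols≈ r = begin
        M (suc r) (punchIn j (inject₁ c′)) ≡⟨ ≡.cong (M (suc r)) pc′≡c ⟩
        M (suc r) (inject₁ c)              ≈⟨ cols≈ (suc r) ⟩
        M (suc r) (suc c)                  ≡⟨ ≡.cong (M (suc r)) pc′+1≡c+1 ⟨
        M (suc r) (punchIn j (suc c′))     ∎
    minors≈ : ∀ r s → minor M (inject₁ c) r s ≈ minor M (suc c) r s
    minors≈ r s with punchIn-adjacent c s
    ... | inj₁ same          = reflexive (≡.cong (M (suc r)) same)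
    ... | inj₂ (p≡c+1 , p′≡c) = begin
      M (suc r) (punchIn (inject₁ c) s) ≡⟨ ≡.cong (M (suc r)) p≡c+1 ⟩
      M (suc r) (suc c)                 ≈⟨ cols≈ (suc r) ⟨
      M (suc r) (inject₁ c)             ≡⟨ ≡.cong (M (suc r)) p′≡c ⟨
      M (suc r) (punchIn (suc c) s)     ∎
    pairCancels : T (inject₁ c) + T (suc c) ≈ 0# + 0#
    pairCancels = begin
      T (inject₁ c) + T (suc c)
        ≈⟨ +-congʳ (*-cong (reflexive (sgn-inject₁ c)) (*-cong (cols≈ zero) (det-cong (suc k) minors≈))) ⟩
      sgn c * X + - sgn c * X
        ≈⟨ distribʳ X (sgn c) (- sgn c) ⟨
      (sgn c + - sgn c) * X
        ≈⟨ *-congʳ (-‿inverseʳ (sgn c)) ⟩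
      0# * X
        ≈⟨ zeroˡ X ⟩
      0#
        ≈⟨ +-identityʳ 0# ⟨
      0# + 0# ∎
      where
      X = M zero (suc c) * det (suc k) (minor M (suc c))

  det-transposeAdj : ∀ {k} (M : Matrix (suc k) (suc k)) (c : Fin k) →
    det (suc k) (λ r t → M r (transposeAdj c t)) ≈ - det (suc k) M
  det-transposeAdj {suc k} M c = begin
    det (suc (suc k)) Mτ     ≡⟨ det-expand (suc k) Mτ ⟩
    sum (term Mτ)            ≈⟨ sum-adjacentPair c {f = term Mτ} offPair pairSwaps ⟩
    sum (λ j → - term M j)   ≈⟨ -‿sum (term M) ⟨
    - sum (term M)           ≡⟨ ≡.cong -_ (det-expand (suc k) M) ⟨
    - det (suc (suc k)) M    ∎
    where
    Mτ : Matrix (suc (suc k)) (suc (suc k))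
    Mτ r t = M r (transposeAdj c t)
    term = expansionTerm
    offPair : ∀ j → j ≢ inject₁ c → j ≢ suc c → term Mτ j ≈ - term M j
    offPair j j≢c j≢c+1 with punchIn-transposeAdj c j≢c j≢c+1
    ... | c′ , _ , _ , commute = begin
      sgn j * (M zero (transposeAdj c j) * det (suc k) (minor Mτ j))
        ≈⟨ *-congˡ (*-cong (reflexive (≡.cong (M zero) (transposeAdj-fix c j≢c j≢c+1))) minor≈) ⟩
      sgn j * (M zero j * - det (suc k) (minor M j))
        ≈⟨ *-congˡ (-‿distribʳ-* _ _) ⟨
      sgn j * - (M zero j * det (suc k) (minor M j))
        ≈⟨ -‿distribʳ-* _ _ ⟨
      - term M j ∎
      where
      minor≈ : det (suc k) (minor Mτ j) ≈ - det (suc k) (minor M j)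
      minor≈ = begin
        det (suc k) (minor Mτ j)
          ≈⟨ det-cong (suc k) (λ r s → reflexive (≡.cong (M (suc r)) (commute s))) ⟩
        det (suc k) (λ r s → minor M j r (transposeAdj c′ s))
          ≈⟨ det-transposeAdj (minor M j) c′ ⟩
        - det (suc k) (minor M j) ∎
    pairSwaps : term Mτ (inject₁ c) + term Mτ (suc c) ≈ - term M (inject₁ c) + - term M (suc c)
    pairSwaps = begin
      term Mτ (inject₁ c) + term Mτ (suc c)
        ≈⟨ +-cong (*-cong (reflexive (sgn-inject₁ c)) (*-cong (Mτ-entry (transposeAdj-inject₁ c))
                                                              (Mτ-minor (transposeAdj-punchIn-inject₁ c))))
                  (*-congˡ (*-cong (Mτ-entry (transposeAdj-suc c)) (Mτ-minor (transposeAdj-punchIn-suc c)))) ⟩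
      sgn c * X₊ + - sgn c * X₋
        ≈⟨ +-comm _ _ ⟩
      - sgn c * X₋ + sgn c * X₊
        ≈⟨ +-cong (-‿distribˡ-* (sgn c) X₋) (-‿involutive (sgn c * X₊)) ⟨
      - (sgn c * X₋) + - - (sgn c * X₊)
        ≈⟨ +-cong (-‿cong (*-congʳ (reflexive (≡.sym (sgn-inject₁ c))))) (-‿cong (-‿distribˡ-* (sgn c) X₊)) ⟩
      - term M (inject₁ c) + - term M (suc c) ∎
      where
      X₋ = M zero (inject₁ c) * det (suc k) (minor M (inject₁ c))
      X₊ = M zero (suc c) * det (suc k) (minor M (suc c))
      Mτ-entry : ∀ {j j′} → transposeAdj c j ≡ j′ → Mτ zero j ≈ M zero j′
      Mτ-entry = reflexive ∘ ≡.cong (M zero)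
      Mτ-minor : ∀ {j j′} → (∀ s → transposeAdj c (punchIn j s) ≡ punchIn j′ s) →
        det (suc k) (minor Mτ j) ≈ det (suc k) (minor M j′)
      Mτ-minor τ∘punchIn = det-cong (suc k) (λ r s → reflexive (≡.cong (M (suc r)) (τ∘punchIn s)))

  det-moveToLast : ∀ {k} (q : Fin (suc k)) (M : Matrix (suc k) (suc k)) →
    det (suc k) (λ r t → M r (moveToLast q t)) ≈ sgnToLast q * det (suc k) M
  det-moveToLast {k} = >-weakInduction P base step
    where
    P : Fin (suc k) → Set (c ⊔ ℓ)
    P q = ∀ M → det (suc k) (λ r t → M r (moveToLast q t)) ≈ sgnToLast q * det (suc k) M
    base : P (fromℕ k)
    base M = begin
      det (suc k) (λ r t → M r (moveToLast (fromℕ k) t))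
        ≈⟨ det-cong (suc k) (λ r t → reflexive (≡.cong (M r) (moveToLast-fromℕ k t))) ⟩
      det (suc k) M
        ≈⟨ *-identityˡ _ ⟨
      1# * det (suc k) M
        ≡⟨ ≡.cong (_* det (suc k) M) (sgnToLast-fromℕ k) ⟨
      sgnToLast (fromℕ k) * det (suc k) M ∎
    step : ∀ i → P (suc i) → P (inject₁ i)
    step i P[i+1] M = begin
      det (suc k) (λ r t → M r (moveToLast (inject₁ i) t))
        ≈⟨ det-cong (suc k) (λ r t → reflexive (≡.cong (M r) (moveToLast-inject₁ i t))) ⟩
      det (suc k) (λ r t → M r (transposeAdj i (moveToLast (suc i) t)))
        ≈⟨ P[i+1] (λ r t → M r (transposeAdj i t)) ⟩
      sgnToLast (suc i) * det (suc k) (λ r t → M r (transposeAdj i t))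
        ≈⟨ *-congˡ (det-transposeAdj M i) ⟩
      sgnToLast (suc i) * - det (suc k) M
        ≈⟨ -‿distribʳ-* _ _ ⟨
      - (sgnToLast (suc i) * det (suc k) M)
        ≈⟨ -‿distribˡ-* _ _ ⟩
      - sgnToLast (suc i) * det (suc k) M
        ≡⟨ ≡.cong (_* det (suc k) M) (sgnToLast-inject₁ i) ⟨
      sgnToLast (inject₁ i) * det (suc k) M ∎

  det-columnEqualsLast : ∀ {k} (M : Matrix (suc k) (suc k)) (t : Fin k) →
    (∀ r → M r (inject₁ t) ≈ M r (fromℕ k)) → det (suc k) M ≈ 0#
  det-columnEqualsLast {suc k} M t col≈last = sgnToLast-cancel (inject₁ t) (begin
    sgnToLast (inject₁ t) * det (suc (suc k)) M  ≈⟨ det-moveToLast (inject₁ t) M ⟨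
    det (suc (suc k)) Mσ                         ≈⟨ det-adjacentColumns≈ Mσ (fromℕ k) lastTwo≈ ⟩
    0#                                           ∎)
    where
    Mσ : Matrix (suc (suc k)) (suc (suc k))
    Mσ r u = M r (moveToLast (inject₁ t) u)
    lastTwo≈ : ∀ r → Mσ r (inject₁ (fromℕ k)) ≈ Mσ r (fromℕ (suc k))
    lastTwo≈ r = begin
      M r (moveToLast (inject₁ t) (inject₁ (fromℕ k)))
        ≡⟨ ≡.cong (M r) (insertAt-last-inject₁ (punchIn (inject₁ t)) (inject₁ t) (fromℕ k)) ⟩
      M r (punchIn (inject₁ t) (fromℕ k))
        ≡⟨ ≡.cong (M r) (punchIn-inject₁-fromℕ t) ⟩
      M r (fromℕ (suc k))
        ≈⟨ col≈last r ⟨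
      M r (inject₁ t)
        ≡⟨ ≡.cong (M r) (insertAt-lookup (punchIn (inject₁ t)) (fromℕ (suc k)) (inject₁ t)) ⟨
      M r (moveToLast (inject₁ t) (fromℕ (suc k))) ∎

  sum-interchange : ∀ {k l} (a b : Vector Carrier k) (e y : Vector Carrier l) (d : Fin k → Fin l → Carrier) →
    sum (λ j → a j * (b j * sum (λ s → e s * d j s * y s))) ≈
    sum (λ s → e s * sum (λ j → a j * (b j * d j s)) * y s)
  sum-interchange a b e y d = begin
    sum (λ j → a j * (b j * sum (λ s → e s * d j s * y s)))
      ≈⟨ sum-cong-≋ (λ j → trans (*-congˡ (*-distribˡ-sum (b j) (λ s → e s * d j s * y s)))
                                 (*-distribˡ-sum (a j) (λ s → b j * (e s * d j s * y s)))) ⟩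
    sum (λ j → sum (λ s → a j * (b j * (e s * d j s * y s))))
      ≈⟨ ∑-comm (λ j s → a j * (b j * (e s * d j s * y s))) ⟩
    sum (λ s → sum (λ j → a j * (b j * (e s * d j s * y s))))
      ≈⟨ sum-cong-≋ (λ s → sum-cong-≋ (λ j → rotate (a j) (b j) (e s) (d j s) (y s))) ⟩
    sum (λ s → sum (λ j → y s * (e s * (a j * (b j * d j s)))))
      ≈⟨ sum-cong-≋ factorOut ⟨
    sum (λ s → e s * sum (λ j → a j * (b j * d j s)) * y s) ∎
    where
    rotate : ∀ a b e d y → a * (b * (e * d * y)) ≈ y * (e * (a * (b * d)))
    rotate = solve 5 (λ a b e d y → a ⊕ (b ⊕ ((e ⊕ d) ⊕ y)) ⊜ y ⊕ (e ⊕ (a ⊕ (b ⊕ d)))) refl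
    factorOut : ∀ s → e s * sum (λ j → a j * (b j * d j s)) * y s ≈
                      sum (λ j → y s * (e s * (a j * (b j * d j s))))
    factorOut s = begin
      e s * sum f * y s              ≈⟨ *-comm _ (y s) ⟩
      y s * (e s * sum f)            ≈⟨ *-congˡ (*-distribˡ-sum (e s) f) ⟩
      y s * sum (λ j → e s * f j)    ≈⟨ *-distribˡ-sum (y s) (λ j → e s * f j) ⟩
      sum (λ j → y s * (e s * f j))  ∎
      where
      f : Vector Carrier _
      f j = a j * (b j * d j s)

  lastCofactor : ∀ {k} → Matrix (suc k) k → Fin (suc k) → Carrier
  lastCofactor {k} B s = sgnToLast s * det k (B ∘ punchIn s)

  det-laplaceLast : ∀ k (B : Matrix (suc k) k) (x : Vector Carrier (suc k)) →
    det (suc k) (λ r → insertAt (B r) (fromℕ k) (x r)) ≈ sum (λ s → lastCofactor B s * x s)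
  det-laplaceLast zero    B x = +-congʳ (regroup 1# (x zero) 1#)
  det-laplaceLast (suc k) B x = begin
    det (suc (suc k)) N                                         ≡⟨ det-expand (suc k) N ⟩
    sum T                                                       ≈⟨ sum-init-last T ⟩
    sum (T ∘ inject₁) + T (fromℕ (suc k))                       ≈⟨ +-cong firstColumns lastColumn ⟩
    sum (λ s → expansion (suc s)) + expansion zero              ≈⟨ +-comm _ _ ⟩
    sum expansion                                               ∎
    where
    N : Matrix (suc (suc k)) (suc (suc k))
    N r = insertAt (B r) (fromℕ (suc k)) (x r)
    T = expansionTerm N
    expansion : Vector Carrier (suc (suc k))
    expansion s = lastCofactor B s * x s
    lastColumn : T (fromℕ (suc k)) ≈ expansion zero
    lastColumn = trans
      (*-congˡ (*-cong (reflexive (insertAt-lookup (B zero) (fromℕ (suc k)) (x zero)))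
        (det-cong (suc k) (λ r s → reflexive (insertAt-punchIn (B (suc r)) (fromℕ (suc k)) (x (suc r)) s)))))
      (regroup _ _ _)
    D : Fin (suc k) → Fin (suc k) → Carrier
    D j s = det k (λ r t → B (suc (punchIn s r)) (punchIn j t))
    minorExpansion : ∀ j → T (inject₁ j) ≈ sgn j * (B zero j * sum (λ s → sgnToLast s * D j s * x (suc s)))
    minorExpansion j = *-cong (reflexive (sgn-inject₁ j)) (*-cong
      (reflexive (insertAt-last-inject₁ (B zero) (x zero) j))
      (trans (det-cong (suc k) (λ r s → reflexive (insertAt-last-punchIn (B (suc r)) (x (suc r)) j s)))
             (det-laplaceLast k (λ r t → B (suc r) (punchIn j t)) (x ∘ suc))))
    firstColumns : sum (T ∘ inject₁) ≈ sum (λ s → expansion (suc s))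
    firstColumns = begin
      sum (T ∘ inject₁)
        ≈⟨ sum-cong-≋ minorExpansion ⟩
      sum (λ j → sgn j * (B zero j * sum (λ s → sgnToLast s * D j s * x (suc s))))
        ≈⟨ sum-interchange sgn (B zero) sgnToLast (x ∘ suc) D ⟩
      sum (λ s → sgnToLast s * sum (λ j → sgn j * (B zero j * D j s)) * x (suc s))
        ≈⟨ sum-cong-≋ (λ s → *-congʳ {x (suc s)} (*-congˡ {sgnToLast s}
             (reflexive (≡.sym (det-expand k (B ∘ punchIn (suc s))))))) ⟩
      sum (λ s → expansion (suc s)) ∎

  snoc≗insertAt : ∀ {k} (f : Vector Carrier k) y → snoc f y ≗ insertAt f (fromℕ k) y
  snoc≗insertAt {zero}  f y zero    = ≡.refl
  snoc≗insertAt {suc k} f y zero    = ≡.refl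
  snoc≗insertAt {suc k} f y (suc i) = snoc≗insertAt (f ∘ suc) y i

  infix 7 _·_
  _·_ : ∀ {k} → Vector Carrier k → Vector Carrier k → Carrier
  u · w = sum (λ i → u i * w i)

  ·-distribʳ-+ : ∀ {k} (f g w : Vector Carrier k) → (λ i → f i + g i) · w ≈ f · w + g · w
  ·-distribʳ-+ f g w =
    trans (sum-cong-≋ (λ i → distribʳ (w i) (f i) (g i))) (∑-distrib-+ (λ i → f i * w i) (λ i → g i * w i))

  δ : ∀ {k} → Fin k → Fin k → Carrier
  δ a b with a ≟ b
  ... | yes _ = 1#
  ... | no  _ = 0#

  δ-refl : ∀ {k} (a : Fin k) → δ a a ≈ 1#
  δ-refl a with a ≟ a
  ... | yes _   = refl
  ... | no  a≢a = ⊥-elim (a≢a ≡.refl)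

  δ-≢ : ∀ {k} {a b : Fin k} → a ≢ b → δ a b ≈ 0#
  δ-≢ {a = a} {b} a≢b with a ≟ b
  ... | yes a≡b = ⊥-elim (a≢b a≡b)
  ... | no  _   = refl

  spread : ∀ {k l} → (Fin k → Fin l) → Vector Carrier k → Vector Carrier l
  spread φ a x = sum (λ s → δ (φ s) x * a s)

  spread-single : ∀ {k l} (φ : Fin k → Fin l) a p {x} → (∀ s → s ≢ p → φ s ≢ x) →
    spread φ a x ≈ δ (φ p) x * a p
  spread-single φ a p {x} miss =
    sum-single (λ s → δ (φ s) x * a s) p (λ s s≢p → trans (*-congʳ (δ-≢ (miss s s≢p))) (zeroˡ (a s)))

  spread-· : ∀ {k l} (φ : Fin k → Fin l) a (w : Vector Carrier l) →
    spread φ a · w ≈ sum (λ s → a s * w (φ s))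
  spread-· φ a w = begin
    sum (λ x → sum (λ s → δ (φ s) x * a s) * w x)
      ≈⟨ sum-cong-≋ (λ x → *-distribʳ-sum (w x) (λ s → δ (φ s) x * a s)) ⟩
    sum (λ x → sum (λ s → δ (φ s) x * a s * w x))
      ≈⟨ ∑-comm (λ x s → δ (φ s) x * a s * w x) ⟩
    sum (λ s → sum (λ x → δ (φ s) x * a s * w x))
      ≈⟨ sum-cong-≋ pick ⟩
    sum (λ s → a s * w (φ s)) ∎
    where
    pick : ∀ s → sum (λ x → δ (φ s) x * a s * w x) ≈ a s * w (φ s)
    pick s = begin
      sum (λ x → δ (φ s) x * a s * w x)
        ≈⟨ sum-single _ (φ s) (λ x x≢φs →
             trans (*-congʳ (trans (*-congʳ (δ-≢ (x≢φs ∘ ≡.sym))) (zeroˡ _))) (zeroˡ _)) ⟩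
      δ (φ s) (φ s) * a s * w (φ s)
        ≈⟨ *-congʳ (trans (*-congʳ (δ-refl (φ s))) (*-identityˡ (a s))) ⟩
      a s * w (φ s) ∎

module Arrangement {c ℓ} (F : Field c ℓ) {m n : ℕ} (v : Fin n → Fin m → Field.Carrier F) where
  open Field F hiding (zero)
  open FieldDefs F
  open Determinants F
  open import Algebra.Properties.Semiring.Sum semiring
    using (sum; sum-cong-≋; ∑-comm; *-distribˡ-sum; *-distribʳ-sum)
  open import Relation.Binary.Reasoning.Setoid setoid

  column : Fin m → Vector Carrier n
  column col i = v i col

  normal : (Fin (suc m) → Fin n) → Vector Carrier n
  normal κ = spread κ (lastCofactor (v ∘ κ))

  onHyperplane≈normal· : ∀ (κ : Fin (suc m) → Fin n) z →
    det (suc m) (λ r → snoc (v (κ r)) (z (κ r))) ≈ normal κ · z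
  onHyperplane≈normal· κ z = begin
    det (suc m) (λ r → snoc (v (κ r)) (z (κ r)))
      ≈⟨ det-cong (suc m) (λ r t → reflexive (snoc≗insertAt (v (κ r)) (z (κ r)) t)) ⟩
    det (suc m) (λ r → insertAt (v (κ r)) (fromℕ m) (z (κ r)))
      ≈⟨ det-laplaceLast m (v ∘ κ) (z ∘ κ) ⟩
    sum (λ s → lastCofactor (v ∘ κ) s * z (κ s))
      ≈⟨ spread-· κ (lastCofactor (v ∘ κ)) z ⟨
    normal κ · z ∎

  normal·column : ∀ κ col → normal κ · column col ≈ 0#
  normal·column κ col = begin
    normal κ · column col  ≈⟨ onHyperplane≈normal· κ (column col) ⟨
    det (suc m) M          ≈⟨ det-columnEqualsLast M col repeated ⟩
    0#                     ∎
    where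
    M : Matrix (suc m) (suc m)
    M r = snoc (v (κ r)) (v (κ r) col)
    repeated : ∀ r → M r (inject₁ col) ≈ M r (fromℕ m)
    repeated r = reflexive (≡.trans (snoc≗insertAt (v (κ r)) _ (inject₁ col)) (≡.trans
      (insertAt-last-inject₁ (v (κ r)) _ col)
      (≡.sym (≡.trans (snoc≗insertAt (v (κ r)) _ (fromℕ m)) (insertAt-lookup (v (κ r)) (fromℕ m) _)))))

  module _ (independent : NormalSystem v) where

    rowRelation-trivial : ∀ {k} → k ℕ.≤ m → (R : Fin k → Fin n) → (∀ a b → R a ≡ R b → a ≡ b) →
      (a : Vector Carrier k) → (∀ col → sum (λ t → a t * v (R t) col) ≈ 0#) → ∀ t → a t ≈ 0#
    rowRelation-trivial {k} k≤m R R-inj a combination≈0 =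
      independent k k≤m R R-inj a (λ col → trans (reflexive (sumF≡sum k _)) (combination≈0 col))

    -- Descent: if all k-minors of k independent rows vanished, the last-column cofactors of
    -- any bordered (k-1)-column selection would be a linear relation among those rows, so all
    -- (k-1)-minors of the first k-1 rows would vanish too, down to the empty minor 1.
    minors-notAllZero : ∀ k (R : Fin k → Fin n) → k ℕ.≤ m → (∀ a b → R a ≡ R b → a ≡ b) →
      ¬ (∀ γ → StrictlyIncreasing γ → det k (λ r t → v (R r) (γ t)) ≈ 0#)
    minors-notAllZero zero    R _   _     allZero = 1≉0 (allZero (λ ()) (λ ()))
    minors-notAllZero (suc k) R k<m R-inj allZero =
      minors-notAllZero k (R ∘ inject₁) (ℕ.<⇒≤ k<m) (λ a b → inject₁-injective ∘ R-inj _ _) topMinorsZero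
      where
      topMinorsZero : ∀ γ → StrictlyIncreasing γ → det k (λ r t → v (R (inject₁ r)) (γ t)) ≈ 0#
      topMinorsZero γ γ↑ = trans
        (det-cong k (λ r t → reflexive (≡.cong (λ i → v (R i) (γ t)) (≡.sym (punchIn-fromℕ r)))))
        (sgnToLast-cancel (fromℕ k) (rowRelation-trivial k<m R R-inj (lastCofactor B) combination≈0 (fromℕ k)))
        where
        B : Matrix (suc k) k
        B r t = v (R r) (γ t)
        bordered : Fin m → Matrix (suc k) (suc k)
        bordered col r = insertAt (B r) (fromℕ k) (v (R r) col)
        bordered≈0 : ∀ col → det (suc k) (bordered col) ≈ 0#
        bordered≈0 col with any? (λ t → γ t ≟ col)
        ... | yes (t , γt≡col) = det-columnEqualsLast (bordered col) t λ r → reflexive (≡.trans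
                (insertAt-last-inject₁ (B r) _ t)
                (≡.trans (≡.cong (v (R r)) γt≡col) (≡.sym (insertAt-lookup (B r) (fromℕ k) _))))
        ... | no col∉γ with insertAt-strictlyIncreasing γ↑ col (λ t γt≡col → col∉γ (t , γt≡col))
        ...   | q , γ′↑ = begin
          det (suc k) (bordered col)
            ≈⟨ det-cong (suc k) (λ r u → reflexive (entries r u)) ⟩
          det (suc k) (λ r u → v (R r) (γ′ (moveToLast q u)))
            ≈⟨ det-moveToLast q (λ r u → v (R r) (γ′ u)) ⟩
          sgnToLast q * det (suc k) (λ r u → v (R r) (γ′ u))
            ≈⟨ *-congˡ (allZero γ′ γ′↑) ⟩
          sgnToLast q * 0#
            ≈⟨ zeroʳ _ ⟩
          0# ∎
          where
          γ′ = insertAt γ q col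
          entries : ∀ r u → bordered col r u ≡ v (R r) (γ′ (moveToLast q u))
          entries r u = ≡.sym (≡.trans
            (insertAt-map (v (R r) ∘ γ′) (punchIn q) (fromℕ k) q u)
            (insertAt-cong (fromℕ k) (≡.cong (v (R r)) ∘ insertAt-punchIn γ q col)
              (≡.cong (v (R r)) (insertAt-lookup γ q col)) u))
        combination≈0 : ∀ col → sum (λ s → lastCofactor B s * v (R s) col) ≈ 0#
        combination≈0 col = trans (sym (det-laplaceLast k B (λ r → v (R r) col))) (bordered≈0 col)

    det≉0 : (I : Fin m → Fin n) → StrictlyIncreasing I → ¬ det m (v ∘ I) ≈ 0#
    det≉0 I I↑ det≈0 = minors-notAllZero m I ℕ.≤-refl (strictlyIncreasing⇒injective I↑)
      λ γ γ↑ → trans (det-cong m (λ r t → reflexive (≡.cong (v (I r)) (strictlyIncreasing-endo≗id γ↑ t)))) det≈0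

    module Spanning (I : Fin m → Fin n) (I↑ : StrictlyIncreasing I) where

      _∈I? : ∀ x → Dec (∃ λ t → I t ≡ x)
      x ∈I? = any? (λ t → I t ≟ x)

      _∉I : Fin n → Set
      x ∉I = ¬ (∃ λ t → I t ≡ x)

      module Insertion (j : Fin n) (j∉I : j ∉I) where

        private
          insertion = insertAt-strictlyIncreasing I↑ j (λ t It≡j → j∉I (t , It≡j))

        pivot : Fin (suc m)
        pivot = proj₁ insertion

        κ : Fin (suc m) → Fin n
        κ = insertAt I pivot j

        κ↑ : StrictlyIncreasing κ
        κ↑ = proj₂ insertion

        μ : Carrier
        μ = lastCofactor (v ∘ κ) pivot

        μ≉0 : ¬ μ ≈ 0#
        μ≉0 μ≈0 = det≉0 I I↑ (sgnToLast-cancel pivot (trans (sym μ≈) μ≈0))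
          where
          μ≈ : μ ≈ sgnToLast pivot * det m (v ∘ I)
          μ≈ = *-congˡ (det-cong m (λ r t → reflexive (≡.cong (λ i → v i t) (insertAt-punchIn I pivot j r))))

        μ⁻¹ : Carrier
        μ⁻¹ = proj₁ (inverse μ μ≉0)

        μμ⁻¹≈1 : μ * μ⁻¹ ≈ 1#
        μμ⁻¹≈1 = proj₂ (inverse μ μ≉0)

        normal-outside : ∀ x → x ∉I → normal κ x ≈ δ j x * μ
        normal-outside x x∉I = trans (spread-single κ (lastCofactor (v ∘ κ)) pivot misses)
          (*-congʳ (reflexive (≡.cong (λ i → δ i x) (insertAt-lookup I pivot j))))
          where
          misses : ∀ s → s ≢ pivot → κ s ≢ x
          misses s s≢pivot κs≡x with pivot-or-punchIn pivot s
          ... | inj₁ s≡pivot       = s≢pivot s≡pivot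
          ... | inj₂ (t , ≡.refl) = x∉I (t , ≡.trans (≡.sym (insertAt-punchIn I pivot j t)) κs≡x)

      open Insertion using (κ; μ⁻¹)

      _⊥insertions : Vector Carrier n → Set ℓ
      u ⊥insertions = ∀ j j∉I → normal (κ j j∉I) · u ≈ 0#

      correctionTerm : Vector Carrier n → ∀ j → Dec (∃ λ t → I t ≡ j) → Vector Carrier n
      correctionTerm w j (yes _)   x = 0#
      correctionTerm w j (no j∉I)  x = w j * μ⁻¹ j j∉I * normal (κ j j∉I) x

      correction : Vector Carrier n → Vector Carrier n
      correction w x = sum (λ j → correctionTerm w j (j ∈I?) x)

      correctionTerm-outside : ∀ w j d x → x ∉I → j ≢ x → correctionTerm w j d x ≈ 0#
      correctionTerm-outside w j (yes _)  x x∉I j≢x = refl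
      correctionTerm-outside w j (no j∉I) x x∉I j≢x = begin
        w j * μ⁻¹ j j∉I * normal (κ j j∉I) x  ≈⟨ *-congˡ (Insertion.normal-outside j j∉I x x∉I) ⟩
        w j * μ⁻¹ j j∉I * (δ j x * _)         ≈⟨ *-congˡ (trans (*-congʳ (δ-≢ j≢x)) (zeroˡ _)) ⟩
        w j * μ⁻¹ j j∉I * 0#                  ≈⟨ zeroʳ _ ⟩
        0#                                    ∎

      correctionTerm-diagonal : ∀ w x d → x ∉I → correctionTerm w x d x ≈ w x
      correctionTerm-diagonal w x (yes x∈I) x∉I = ⊥-elim (x∉I x∈I)
      correctionTerm-diagonal w x (no x∉I)  _   = begin
        w x * μ⁻¹ x x∉I * normal (κ x x∉I) x   ≈⟨ *-congˡ (Insertion.normal-outside x x∉I x x∉I) ⟩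
        w x * μ⁻¹ x x∉I * (δ x x * μ x x∉I)    ≈⟨ *-congˡ (trans (*-congʳ (δ-refl x)) (*-identityˡ _)) ⟩
        w x * μ⁻¹ x x∉I * μ x x∉I              ≈⟨ *-assoc _ _ _ ⟩
        w x * (μ⁻¹ x x∉I * μ x x∉I)            ≈⟨ *-congˡ (trans (*-comm _ _) (Insertion.μμ⁻¹≈1 x x∉I)) ⟩
        w x * 1#                               ≈⟨ *-identityʳ _ ⟩
        w x                                    ∎
        where open Insertion using (μ)

      correction-outside : ∀ w x → x ∉I → correction w x ≈ w x
      correction-outside w x x∉I = trans
        (sum-single (λ j → correctionTerm w j (j ∈I?) x) x
          (λ j j≢x → correctionTerm-outside w j (j ∈I?) x x∉I j≢x))
        (correctionTerm-diagonal w x (x ∈I?) x∉I)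

      correctionTerm-orthogonal : ∀ w u → u ⊥insertions →
        ∀ j d → correctionTerm w j d · u ≈ 0#
      correctionTerm-orthogonal w u u⊥ j (yes _)  = sum-zero (λ x → zeroˡ (u x))
      correctionTerm-orthogonal w u u⊥ j (no j∉I) = begin
        sum (λ x → a * normal (κ j j∉I) x * u x)    ≈⟨ sum-cong-≋ (λ x → *-assoc a _ (u x)) ⟩
        sum (λ x → a * (normal (κ j j∉I) x * u x))  ≈⟨ *-distribˡ-sum a (λ x → normal (κ j j∉I) x * u x) ⟨
        a * (normal (κ j j∉I) · u)                  ≈⟨ *-congˡ (u⊥ j j∉I) ⟩
        a * 0#                                      ≈⟨ zeroʳ a ⟩
        0#                                          ∎
        where a = w j * μ⁻¹ j j∉I

      correction-orthogonal : ∀ w u → u ⊥insertions → correction w · u ≈ 0#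
      correction-orthogonal w u u⊥ = begin
        sum (λ x → sum (λ j → term j x) * u x)   ≈⟨ sum-cong-≋ (λ x → *-distribʳ-sum (u x) (λ j → term j x)) ⟩
        sum (λ x → sum (λ j → term j x * u x))   ≈⟨ ∑-comm (λ x j → term j x * u x) ⟩
        sum (λ j → term j · u)                   ≈⟨ sum-zero (λ j → correctionTerm-orthogonal w u u⊥ j (j ∈I?)) ⟩
        0#                                       ∎
        where
        term : Fin n → Vector Carrier n
        term j = correctionTerm w j (j ∈I?)

      supported⇒zero : ∀ g → (∀ x → x ∉I → g x ≈ 0#) →
        (∀ col → g · column col ≈ 0#) → ∀ x → g x ≈ 0#
      supported⇒zero g outside≈0 g⊥ x with x ∈I?
      ... | yes (t , ≡.refl) = onI≈0 t
        where
        g≈spread : ∀ x → g x ≈ spread I (g ∘ I) x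
        g≈spread x with x ∈I?
        ... | yes (t , ≡.refl) = sym (trans
                (spread-single I (g ∘ I) t (λ s s≢t → s≢t ∘ strictlyIncreasing⇒injective I↑ s t))
                (trans (*-congʳ (δ-refl (I t))) (*-identityˡ _)))
        ... | no x∉I = trans (outside≈0 x x∉I)
                (sym (sum-zero (λ s → trans (*-congʳ (δ-≢ (x∉I ∘ (s ,_)))) (zeroˡ _))))
        onI≈0 : ∀ t → g (I t) ≈ 0#
        onI≈0 = rowRelation-trivial ℕ.≤-refl I (strictlyIncreasing⇒injective I↑) (g ∘ I) λ col → begin
          sum (λ t → g (I t) * v (I t) col)  ≈⟨ spread-· I (g ∘ I) (column col) ⟨
          spread I (g ∘ I) · column col      ≈⟨ sum-cong-≋ (λ y → *-congʳ (g≈spread y)) ⟨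
          g · column col                     ≈⟨ g⊥ col ⟩
          0#                                 ∎
      ... | no x∉I = outside≈0 x x∉I

      orthogonalToInsertions : ∀ u → u ⊥insertions →
        ∀ ι → normal ι · u ≈ 0#
      orthogonalToInsertions u u⊥ ι = begin
        w · u                      ≈⟨ split u ⟩
        g · u + correction w · u   ≈⟨ +-cong (sum-zero (λ x → trans (*-congʳ (g≈0 x)) (zeroˡ (u x))))
                                             (correction-orthogonal w u u⊥) ⟩
        0# + 0#                    ≈⟨ +-identityʳ 0# ⟩
        0#                         ∎
        where
        w = normal ι
        g : Vector Carrier n
        g x = w x - correction w x
        split : ∀ u → w · u ≈ g · u + correction w · u
        split u = trans (sum-cong-≋ (λ x → *-congʳ (sym (minusPlus (w x) (correction w x)))))
                        (·-distribʳ-+ g (correction w) u)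
          where
          minusPlus : ∀ a b → a - b + b ≈ a
          minusPlus a b = trans (+-assoc a (- b) b) (trans (+-congˡ (-‿inverseˡ b)) (+-identityʳ a))
        g⊥ : ∀ col → g · column col ≈ 0#
        g⊥ col = begin
          g · column col                                   ≈⟨ +-identityʳ _ ⟨
          g · column col + 0#                              ≈⟨ +-congˡ correction⊥column ⟨
          g · column col + correction w · column col       ≈⟨ split (column col) ⟨
          w · column col                                   ≈⟨ normal·column ι col ⟩
          0#                                               ∎
          where
          correction⊥column = correction-orthogonal w (column col) (λ j j∉I → normal·column (κ j j∉I) col)
        g≈0 : ∀ x → g x ≈ 0#
        g≈0 = supported⇒zero g
          (λ x x∉I → trans (+-congˡ (-‿cong (correction-outside w x x∉I))) (-‿inverseʳ (w x))) g⊥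

mainTheorem2 : ∀ {c ℓ} (F : Field c ℓ) (m n : ℕ) → 1 ≤ m → m < n →
    (v : Fin n → Fin m → Field.Carrier F) →
    FieldDefs.NormalSystem F v →
    (I : Fin m → Fin n) → StrictlyIncreasing I →
    (y : Fin n → Field.Carrier F) →
    (∀ j → ¬ (∃ λ k → I k ≡ j) →
      ∀ (ι : Fin (suc m) → Fin n) → StrictlyIncreasing ι →
      (∀ x → (∃ λ k → ι k ≡ x) → (∃ λ k → I k ≡ x) ⊎ x ≡ j) →
      (∀ x → (∃ λ k → I k ≡ x) ⊎ x ≡ j → ∃ λ k → ι k ≡ x) →
      FieldDefs.OnHyperplane F v y ι) →
    ∀ (ι : Fin (suc m) → Fin n) → StrictlyIncreasing ι →
    FieldDefs.OnHyperplane F v y ι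
mainTheorem2 F m n _ _ v independent I I↑ y onInsertions ι _ = begin
  det (suc m) (λ r → snoc (v (ι r)) (y (ι r)))  ≈⟨ onHyperplane≈normal· ι y ⟩
  normal ι · y                                  ≈⟨ orthogonalToInsertions y y⊥ ι ⟩
  0#                                            ∎
  where
  open Field F using (_≈_; 0#; setoid; sym; trans)
  open FieldDefs F
  open Determinants F
  open Arrangement F v
  open Spanning independent I I↑
  open Insertion using (κ; κ↑; pivot)
  open import Relation.Binary.Reasoning.Setoid setoid
  y⊥ : y ⊥insertions
  y⊥ j j∉I = trans (sym (onHyperplane≈normal· (κ j j∉I) y))
    (onInsertions j j∉I (κ j j∉I) (κ↑ j j∉I)
      (λ x → insertAt-image I (pivot j j∉I) j) (λ x → image-insertAt I (pivot j j∉I) j))
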